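{- Let $(\mathcal{A},\Omega,\Diamond,\mathcal{S})$ be a monadic core. Then the triple $\left(\Omega^{\mathcal{A}},\ \mathcal{S},\ \cdot\xrightarrow{\cdot}\cdot\right)$ forms an evidenced frame, where for $\phi_1,\phi_2:\mathcal{A}\to\Omega$ and $e\in\mathcal{S}$ the evidence relation is \[\phi_1\xrightarrow{e}\phi_2 \;:=\; \forall c\in\mathcal{A}.\ \phi_1(c)\le \Diamond(e\cdot c)(\phi_2).\]
   Context: $M$ is a monad on $\mathbf{Set}$ with unit $\eta$ and bind. A monadic combinatory algebra (MCA) $\mathcal{A}$ over $M$ is a set of codes with an application $(-)\cdot(-):\mathcal{A}\times\mathcal{A}\to M\mathcal{A}$ such that every expression $e$ with $n+1$ free variables (built from variables, codes and application) has a code $\langle\lambda^n.e\rangle\in\mathcal{A}$ with $\langle\lambda^{n+1}.e\rangle\cdot c=\eta(\langle\lambda^n.e[c]\rangle)$ and $\langle\lambda^0.e\rangle\cdot c=\nu(e[c])$, where $\nu$ is call-by-value evaluation of closed expressions via return/bind. $(\Omega,\le)$ is a complete Heyting prealgebra with meets $\bigwedge$ (infima), top $\mathbf{1}$, bottom $\mathbf{0}$ and Heyting implication $\Rightarrow$. An $M$-modality is a natural transformation $\Diamond_X:M(X)\to(X\to\Omega)\to\Omega$ (write $\Diamond(m)(\phi)$, read "after $m$ yields $x$, $\phi(x)$ holds") satisfying: (After-Return) $\phi(a)\le\Diamond(\eta(a))(\phi)$; (After-Bind) $\Diamond(m)(\lambda x.\Diamond(f(x))(\phi))\le\Diamond(\mathrm{bind}(m,f))(\phi)$;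 (Internal Monotonicity) $\bigwedge_c(\phi_1(c)\Rightarrow\phi_2(c))\le\Diamond(m)(\phi_1)\Rightarrow\Diamond(m)(\phi_2)$. A separator $\mathcal{S}\subseteq\mathcal{A}$ is a combinatorially complete subset such that for all $c_f,c_a\in\mathcal{S}$, $\Diamond(c_f\cdot c_a)(\lambda r.\mathbf{0})\le\mathbf{0}$. A monadic core is such a tuple $(\mathcal{A},\Omega,\Diamond,\mathcal{S})$. An evidenced frame $(\Phi,E,\cdot\xrightarrow{\cdot}\cdot)$ is a set of propositions $\Phi$, a set of evidence $E$ and a ternary relation on $\Phi\times E\times\Phi$, equipped with evidence for reflexivity and transitivity (composition of evidence), a top proposition, conjunction (pairing and two projections), and universal implication $\supset:\Phi\times\mathcal{P}(\Phi)\to\Phi$ (with currying $\lambda$ and an evaluation evidence), each satisfying the evidenced analogues of the Heyting prealgebra axioms uniformly. -}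

module Defs where

open import Level using (Level; _⊔_) renaming (suc to lsuc)
open import Data.Nat using (ℕ; zero; suc)
open import Data.Fin using (Fin; zero; suc)
open import Data.Product using (Σ; _×_; _,_; proj₁; proj₂)
open import Data.Unit.Polymorphic using (⊤)
open import Function using (_∘_)
open import Relation.Binary.PropositionalEquality using (_≡_)

record Monad (ℓ : Level) : Set (lsuc ℓ) where
  field
    M    : Set ℓ → Set ℓ
    η    : {X : Set ℓ} → X → M X
    bind : {X Y : Set ℓ} → M X → (X → M Y) → M Y
    left-unit  : {X Y : Set ℓ} (x : X) (f : X → M Y) → bind (η x) f ≡ f x
    right-unit : {X : Set ℓ} (m : M X) → bind m η ≡ m
    assoc      : {X Y Z : Set ℓ} (m : M X) (f : X → M Y) (g : Y → M Z) →
                 bind (bind m f) g ≡ bind m (λ x → bind (f x) g)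

  fmap : {X Y : Set ℓ} → (X → Y) → M X → M Y
  fmap f m = bind m (η ∘ f)

data Expr {ℓ : Level} (A : Set ℓ) : ℕ → Set ℓ where
  var  : {n : ℕ} → Fin n → Expr A n
  code : {n : ℕ} → A → Expr A n
  app  : {n : ℕ} → Expr A n → Expr A n → Expr A n

subst₀ : {ℓ : Level} {A : Set ℓ} {n : ℕ} → Expr A (suc n) → A → Expr A n
subst₀ (var zero)    c = code c
subst₀ (var (suc i)) c = var i
subst₀ (code a)      c = code a
subst₀ (app e₁ e₂)   c = app (subst₀ e₁ c) (subst₀ e₂ c)

CodesIn : {ℓ ℓ' : Level} {A : Set ℓ} (P : A → Set ℓ') {n : ℕ} → Expr A n → Set ℓ'
CodesIn P (var i)     = ⊤
CodesIn P (code a)    = P a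
CodesIn P (app e₁ e₂) = CodesIn P e₁ × CodesIn P e₂

module _ {ℓ : Level} (𝕄 : Monad ℓ) where
  open Monad 𝕄

  ν : {A : Set ℓ} → (A → A → M A) → Expr A 0 → M A
  ν _·_ (var ())
  ν _·_ (code a)    = η a
  ν _·_ (app e₁ e₂) = bind (ν _·_ e₁) (λ a₁ → bind (ν _·_ e₂) (λ a₂ → a₁ · a₂))

  record MCA : Set (lsuc ℓ) where
    field
      A   : Set ℓ
      _·_ : A → A → M A
      -- ⟨λⁿ.e⟩ for e with n+1 free variables
      lam : (n : ℕ) → Expr A (suc n) → A
      lam-suc  : (n : ℕ) (e : Expr A (suc (suc n))) (c : A) →
                 lam (suc n) e · c ≡ η (lam n (subst₀ e c))
      lam-zero : (e : Expr A 1) (c : A) →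
                 lam 0 e · c ≡ ν _·_ (subst₀ e c)

record CompleteHeytingPrealgebra (ℓ : Level) : Set (lsuc ℓ) where
  infix 3 _≤_
  infixr 6 _∧_
  infixr 5 _∨_
  infixr 4 _⇒_
  field
    Ω   : Set ℓ
    _≤_ : Ω → Ω → Set ℓ
    ≤-refl  : {x : Ω} → x ≤ x
    ≤-trans : {x y z : Ω} → x ≤ y → y ≤ z → x ≤ z
    ⋀ : {I : Set ℓ} → (I → Ω) → Ω
    ⋀-lb  : {I : Set ℓ} (f : I → Ω) (i : I) → ⋀ f ≤ f i
    ⋀-glb : {I : Set ℓ} (f : I → Ω) {x : Ω} → ((i : I) → x ≤ f i) → x ≤ ⋀ f
    ⋁ : {I : Set ℓ} → (I → Ω) → Ω
    ⋁-ub  : {I : Set ℓ} (f : I → Ω) (i : I) → f i ≤ ⋁ f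
    ⋁-lub : {I : Set ℓ} (f : I → Ω) {x : Ω} → ((i : I) → f i ≤ x) → ⋁ f ≤ x
    𝟏 : Ω
    𝟏-top : {x : Ω} → x ≤ 𝟏
    𝟎 : Ω
    𝟎-bot : {x : Ω} → 𝟎 ≤ x
    _∧_ : Ω → Ω → Ω
    ∧-lb₁ : {x y : Ω} → x ∧ y ≤ x
    ∧-lb₂ : {x y : Ω} → x ∧ y ≤ y
    ∧-glb : {x y z : Ω} → z ≤ x → z ≤ y → z ≤ x ∧ y
    _∨_ : Ω → Ω → Ω
    ∨-ub₁ : {x y : Ω} → x ≤ x ∨ y
    ∨-ub₂ : {x y : Ω} → y ≤ x ∨ y
    ∨-lub : {x y z : Ω} → x ≤ z → y ≤ z → x ∨ y ≤ z
    _⇒_ : Ω → Ω → Ω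
    ⇒-intro : {x y z : Ω} → x ∧ y ≤ z → x ≤ y ⇒ z
    ⇒-elim  : {x y z : Ω} → x ≤ y ⇒ z → x ∧ y ≤ z

module _ {ℓ : Level} (𝕄 : Monad ℓ) (H : CompleteHeytingPrealgebra ℓ) where
  open Monad 𝕄
  open CompleteHeytingPrealgebra H

  record Modality : Set (lsuc ℓ) where
    field
      ◇ : {X : Set ℓ} → M X → (X → Ω) → Ω
      natural : {X Y : Set ℓ} (f : X → Y) (m : M X) (φ : Y → Ω) →
                ◇ (fmap f m) φ ≡ ◇ m (φ ∘ f)
      after-return : {X : Set ℓ} (a : X) (φ : X → Ω) → φ a ≤ ◇ (η a) φ
      after-bind : {X Y : Set ℓ} (m : M X) (f : X → M Y) (φ : Y → Ω) →
                   ◇ m (λ x → ◇ (f x) φ) ≤ ◇ (bind m f) φ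
      internal-monotonicity : {X : Set ℓ} (m : M X) (φ₁ φ₂ : X → Ω) →
                   ⋀ (λ (c : X) → φ₁ c ⇒ φ₂ c) ≤ (◇ m φ₁ ⇒ ◇ m φ₂)

record MonadicCore (ℓ : Level) (𝕄 : Monad ℓ) : Set (lsuc ℓ) where
  open Monad 𝕄
  field
    mca : MCA 𝕄
    heyting : CompleteHeytingPrealgebra ℓ
    modality : Modality 𝕄 heyting
  open MCA mca public
  open CompleteHeytingPrealgebra heyting public
  open Modality modality public
  field
    S : A → Set ℓ
    S-comb : (n : ℕ) (e : Expr A (suc n)) → CodesIn S e → S (lam n e)
    S-consistent : (cf ca : A) → S cf → S ca →
                   ◇ (cf · ca) (λ _ → 𝟎) ≤ 𝟎

record EvidencedFrame {ℓΦ ℓE ℓR : Level} (ℓP : Level)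
         (Φ : Set ℓΦ) (E : Set ℓE) (_⊢_⟶_ : Φ → E → Φ → Set ℓR)
         : Set (ℓΦ ⊔ ℓE ⊔ ℓR ⊔ lsuc ℓP) where
  field
    e-id : E
    refl-ev : (φ : Φ) → φ ⊢ e-id ⟶ φ
    _⨾_ : E → E → E
    trans-ev : {φ₁ φ₂ φ₃ : Φ} {e e' : E} →
               φ₁ ⊢ e ⟶ φ₂ → φ₂ ⊢ e' ⟶ φ₃ → φ₁ ⊢ (e ⨾ e') ⟶ φ₃
    ⊤Φ : Φ
    e-⊤ : E
    top-ev : (φ : Φ) → φ ⊢ e-⊤ ⟶ ⊤Φ
    _∧Φ_ : Φ → Φ → Φ
    ⟨_,_⟩ : E → E → E
    e-fst : E
    e-snd : E
    pair-ev : {φ φ₁ φ₂ : Φ} {e₁ e₂ : E} →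
              φ ⊢ e₁ ⟶ φ₁ → φ ⊢ e₂ ⟶ φ₂ → φ ⊢ ⟨ e₁ , e₂ ⟩ ⟶ (φ₁ ∧Φ φ₂)
    fst-ev : (φ₁ φ₂ : Φ) → (φ₁ ∧Φ φ₂) ⊢ e-fst ⟶ φ₁
    snd-ev : (φ₁ φ₂ : Φ) → (φ₁ ∧Φ φ₂) ⊢ e-snd ⟶ φ₂
    -- universal implication, with subsets of Φ as predicates
    _⊃_ : Φ → (Φ → Set ℓP) → Φ
    λ-ev : E → E
    e-eval : E
    curry-ev : {φ₁ φ₂ : Φ} {P : Φ → Set ℓP} {e : E} →
               ((φ : Φ) → P φ → (φ₁ ∧Φ φ₂) ⊢ e ⟶ φ) →
               φ₁ ⊢ λ-ev e ⟶ (φ₂ ⊃ P)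
    eval-ev : (φ₁ : Φ) (P : Φ → Set ℓP) (φ : Φ) → P φ →
              ((φ₁ ⊃ P) ∧Φ φ₁) ⊢ e-eval ⟶ φ

module _ {ℓ : Level} {𝕄 : Monad ℓ} (C : MonadicCore ℓ 𝕄) where
  open MonadicCore C

  CoreEvidence : (A → Ω) → Σ A S → (A → Ω) → Set ℓ
  CoreEvidence φ₁ e φ₂ = (c : A) → φ₁ c ≤ ◇ (proj₁ e · c) φ₂

{-# OPTIONS --safe #-}
module Submission where

-- Evidence is a code of the separator, and every piece of evidence the frame demands is a λ-code
-- over the given evidence, hence in S by combinatorial completeness.
-- Each evidenced axiom then reduces, via After-Return and After-Bind, to the call-by-value
-- computation of that λ-term. Conjunction is realized by Church pairs (queried with true or false),
-- pairing of evidence is delayed until the query arrives, and the evaluation evidence, which must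
-- run two computations in sequence, uses the strength z ∧ ◇ m φ ≤ ◇ m (λ x → z ∧ φ x) that
-- Internal Monotonicity provides.

open import Defs
open import Level using (Level)
open import Data.Product using (Σ; _×_; _,_)
open import Data.Nat using (ℕ; suc)
open import Data.Fin using (zero; suc)
open import Data.Unit.Polymorphic using (tt)

module HeytingPrealgebraProperties {ℓ : Level} (H : CompleteHeytingPrealgebra ℓ) where
  open CompleteHeytingPrealgebra H

  ∧-comm : {x y : Ω} → x ∧ y ≤ y ∧ x
  ∧-comm = ∧-glb ∧-lb₂ ∧-lb₁

  ∧-mono : {x y u v : Ω} → x ≤ u → y ≤ v → x ∧ y ≤ u ∧ v
  ∧-mono x≤u y≤v = ∧-glb (≤-trans ∧-lb₁ x≤u) (≤-trans ∧-lb₂ y≤v)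

module ModalityProperties {ℓ : Level} {𝕄 : Monad ℓ} {H : CompleteHeytingPrealgebra ℓ}
                          (◇ᴹ : Modality 𝕄 H) where
  open Monad 𝕄
  open CompleteHeytingPrealgebra H
  open Modality ◇ᴹ
  open HeytingPrealgebraProperties H

  ◇-strength : {X : Set ℓ} {m : M X} {φ ψ : X → Ω} {z : Ω} →
               ((x : X) → z ∧ φ x ≤ ψ x) → z ∧ ◇ m φ ≤ ◇ m ψ
  ◇-strength {m = m} {φ} {ψ} h =
    ⇒-elim (≤-trans (⋀-glb _ (λ x → ⇒-intro (h x))) (internal-monotonicity m φ ψ))

  ◇-mono : {X : Set ℓ} {m : M X} {φ ψ : X → Ω} → ((x : X) → φ x ≤ ψ x) → ◇ m φ ≤ ◇ m ψ
  ◇-mono h = ≤-trans (∧-glb 𝟏-top ≤-refl) (◇-strength (λ x → ≤-trans ∧-lb₂ (h x)))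

  ◇-sequence : {X Y : Set ℓ} {m : M X} {n : M Y} {φ : X → Ω} {ψ : Y → Ω} {χ : X → Y → Ω} →
               ((x : X) (y : Y) → φ x ∧ ψ y ≤ χ x y) →
               ◇ m φ ∧ ◇ n ψ ≤ ◇ m (λ x → ◇ n (χ x))
  ◇-sequence h = ≤-trans ∧-comm (◇-strength (λ x → ≤-trans ∧-comm (◇-strength (h x))))

module MCAProperties {ℓ : Level} {𝕄 : Monad ℓ} {H : CompleteHeytingPrealgebra ℓ}
                     (◇ᴹ : Modality 𝕄 H) (𝒜 : MCA 𝕄) where
  open Monad 𝕄
  open CompleteHeytingPrealgebra H
  open Modality ◇ᴹ
  open MCA 𝒜
  open HeytingPrealgebraProperties H
  open ModalityProperties ◇ᴹ

  eval : Expr A 0 → M A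
  eval = ν 𝕄 _·_

  ◇₂ : A → A → A → (A → Ω) → Ω
  ◇₂ f a b φ = ◇ (f · a) (λ g → ◇ (g · b) φ)

  ◇-eval-app : {e₁ e₂ : Expr A 0} {φ : A → Ω} →
               ◇ (eval e₁) (λ a → ◇ (eval e₂) (λ b → ◇ (a · b) φ)) ≤ ◇ (eval (app e₁ e₂)) φ
  ◇-eval-app = ≤-trans (◇-mono (λ a → after-bind _ _ _)) (after-bind _ _ _)

  ◇-eval-app-code : {e : Expr A 0} {b : A} {φ : A → Ω} →
                    ◇ (eval e) (λ a → ◇ (a · b) φ) ≤ ◇ (eval (app e (code b))) φ
  ◇-eval-app-code {e} {b} = ≤-trans (◇-mono (λ a → after-return _ _)) (◇-eval-app {e} {code b})

  ◇-eval-code-app : {a : A} {e : Expr A 0} {φ : A → Ω} →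
                    ◇ (eval e) (λ b → ◇ (a · b) φ) ≤ ◇ (eval (app (code a) e)) φ
  ◇-eval-code-app {a} {e} = ≤-trans (after-return _ _) (◇-eval-app {code a} {e})

  ◇-eval-code-code : {a b : A} {φ : A → Ω} → ◇ (a · b) φ ≤ ◇ (eval (app (code a) (code b))) φ
  ◇-eval-code-code {a} = ≤-trans (after-return _ _) (◇-eval-app-code {code a})

  ◇-eval-code-code-code : {f a b : A} {φ : A → Ω} →
                          ◇₂ f a b φ ≤ ◇ (eval (app (app (code f) (code a)) (code b))) φ
  ◇-eval-code-code-code {f} {a} = ≤-trans ◇-eval-code-code (◇-eval-app-code {app (code f) (code a)})

  ◇-lam-zero : {e : Expr A 1} {c : A} {φ : A → Ω} →
               ◇ (eval (subst₀ e c)) φ ≤ ◇ (lam 0 e · c) φ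
  ◇-lam-zero {e} {c} rewrite lam-zero e c = ≤-refl

  ◇-lam-suc : {n : ℕ} {e : Expr A (suc (suc n))} {c : A} {φ : A → Ω} →
              φ (lam n (subst₀ e c)) ≤ ◇ (lam (suc n) e · c) φ
  ◇-lam-suc {n} {e} {c} rewrite lam-suc n e c = after-return _ _

  -- In `lam n e` the variable `var zero` is bound to the FIRST argument supplied. The codes are
  -- I = λx.x, true = λxy.x, false = λxy.y, applyTo a = λc.c a, compose e₁ e₂ = λc.e₂ (e₁ c),
  -- pair = λabs.s a b, fork e₁ e₂ = λcs.s e₁ e₂ c, curry e = λca.e (pair c a) and
  -- applyPair = λc.(c true) (c false); pairing, forked and curried are the values returned by
  -- pair, fork and curry once applied to all but their last argument.
  I : A
  I = lam 0 (var zero)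

  true : A
  true = lam 1 (var zero)

  false : A
  false = lam 1 (var (suc zero))

  applyTo : A → A
  applyTo a = lam 0 (app (var zero) (code a))

  compose : A → A → A
  compose e₁ e₂ = lam 0 (app (code e₂) (app (code e₁) (var zero)))

  pair : A
  pair = lam 2 (app (app (var (suc (suc zero))) (var zero)) (var (suc zero)))

  pairing : A → A → A
  pairing a b = lam 0 (app (app (var zero) (code a)) (code b))

  fork : A → A → A
  fork e₁ e₂ = lam 1 (app (app (app (var (suc zero)) (code e₁)) (code e₂)) (var zero))

  forked : A → A → A → A
  forked e₁ e₂ c = lam 0 (app (app (app (var zero) (code e₁)) (code e₂)) (code c))

  curry : A → A
  curry e = lam 1 (app (code e) (app (app (code pair) (var zero)) (var (suc zero))))

  curried : A → A → A
  curried e c = lam 0 (app (code e) (app (app (code pair) (code c)) (var zero)))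

  applyPair : A
  applyPair = lam 0 (app (app (var zero) (code true)) (app (var zero) (code false)))

  ◇-I : {c : A} {φ : A → Ω} → φ c ≤ ◇ (I · c) φ
  ◇-I = ≤-trans (after-return _ _) ◇-lam-zero

  ◇-true : {a b : A} {φ : A → Ω} → φ a ≤ ◇₂ true a b φ
  ◇-true = ≤-trans (≤-trans (after-return _ _) ◇-lam-zero) ◇-lam-suc

  ◇-false : {a b : A} {φ : A → Ω} → φ b ≤ ◇₂ false a b φ
  ◇-false = ≤-trans ◇-I ◇-lam-suc

  ◇-applyTo : {a c : A} {φ : A → Ω} → ◇ (c · a) φ ≤ ◇ (applyTo a · c) φ
  ◇-applyTo = ≤-trans ◇-eval-code-code ◇-lam-zero

  ◇-compose : {e₁ e₂ c : A} {φ : A → Ω} →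
              ◇ (e₁ · c) (λ b → ◇ (e₂ · b) φ) ≤ ◇ (compose e₁ e₂ · c) φ
  ◇-compose {e₁} {e₂} {c} =
    ≤-trans ◇-eval-code-code (≤-trans (◇-eval-code-app {e = app (code e₁) (code c)}) ◇-lam-zero)

  ◇-pair : {a b : A} {φ : A → Ω} → φ (pairing a b) ≤ ◇₂ pair a b φ
  ◇-pair = ≤-trans ◇-lam-suc ◇-lam-suc

  ◇-pairing : {a b s : A} {φ : A → Ω} → ◇₂ s a b φ ≤ ◇ (pairing a b · s) φ
  ◇-pairing = ≤-trans ◇-eval-code-code-code ◇-lam-zero

  ◇-forked : {e₁ e₂ c s : A} {φ : A → Ω} →
             ◇₂ s e₁ e₂ (λ g → ◇ (g · c) φ) ≤ ◇ (forked e₁ e₂ c · s) φ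
  ◇-forked {e₁} {e₂} {c} {s} =
    ≤-trans ◇-eval-code-code-code
      (≤-trans (◇-eval-app-code {app (app (code s) (code e₁)) (code e₂)}) ◇-lam-zero)

  ◇-curried : {e c a : A} {φ : A → Ω} → ◇ (e · pairing c a) φ ≤ ◇ (curried e c · a) φ
  ◇-curried {e} {c} {a} =
    ≤-trans ◇-pair (≤-trans ◇-eval-code-code-code
      (≤-trans (◇-eval-code-app {e = app (app (code pair) (code c)) (code a)}) ◇-lam-zero))

  ◇-applyPair : {c : A} {φ : A → Ω} →
                ◇ (c · true) (λ d → ◇ (c · false) (λ a → ◇ (d · a) φ)) ≤ ◇ (applyPair · c) φ
  ◇-applyPair {c} =
    ≤-trans (◇-mono (λ d → ◇-eval-code-code)) (≤-trans ◇-eval-code-code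
      (≤-trans (◇-eval-app {app (code c) (code true)} {app (code c) (code false)}) ◇-lam-zero))

  _∧Φ_ : (A → Ω) → (A → Ω) → A → Ω
  (φ₁ ∧Φ φ₂) c = ◇ (c · true) φ₁ ∧ ◇ (c · false) φ₂

  _⊃Φ_ : (A → Ω) → ((A → Ω) → Set ℓ) → A → Ω
  (φ₁ ⊃Φ P) d = ⋀ {I = Σ (A → Ω) (λ φ → P φ × A)} (λ { (φ , _ , a) → φ₁ a ⇒ ◇ (d · a) φ })

  ∧Φ-pairing : {φ₁ φ₂ : A → Ω} {a b : A} → φ₁ a ∧ φ₂ b ≤ (φ₁ ∧Φ φ₂) (pairing a b)
  ∧Φ-pairing = ∧-mono (≤-trans ◇-true ◇-pairing) (≤-trans ◇-false ◇-pairing)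

  ⊃Φ-intro : {φ₁ : A → Ω} {P : (A → Ω) → Set ℓ} {z : Ω} {d : A} →
             ((φ : A → Ω) → P φ → (a : A) → z ∧ φ₁ a ≤ ◇ (d · a) φ) → z ≤ (φ₁ ⊃Φ P) d
  ⊃Φ-intro h = ⋀-glb _ (λ { (φ , Pφ , a) → ⇒-intro (h φ Pφ a) })

  ⊃Φ-elim : {φ₁ φ : A → Ω} {P : (A → Ω) → Set ℓ} {d a : A} →
            P φ → (φ₁ ⊃Φ P) d ∧ φ₁ a ≤ ◇ (d · a) φ
  ⊃Φ-elim {φ = φ} {a = a} Pφ = ⇒-elim (⋀-lb _ (φ , Pφ , a))

module SeparatorEvidence {ℓ : Level} {𝕄 : Monad ℓ} (C : MonadicCore ℓ 𝕄) where
  open MonadicCore C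
  open ModalityProperties modality
  open MCAProperties modality mca public

  Evidence : Set ℓ
  Evidence = Σ A S

  _⊢_⟶_ : (A → Ω) → Evidence → (A → Ω) → Set ℓ
  _⊢_⟶_ = CoreEvidence C

  true∈S : S true
  true∈S = S-comb 1 _ tt

  false∈S : S false
  false∈S = S-comb 1 _ tt

  pair∈S : S pair
  pair∈S = S-comb 2 _ ((tt , tt) , tt)

  e-id : Evidence
  e-id = I , S-comb 0 _ tt

  refl-ev : (φ : A → Ω) → φ ⊢ e-id ⟶ φ
  refl-ev _ _ = ◇-I

  _⨾_ : Evidence → Evidence → Evidence
  (e₁ , s₁) ⨾ (e₂ , s₂) = compose e₁ e₂ , S-comb 0 _ (s₂ , s₁ , tt)

  trans-ev : {φ₁ φ₂ φ₃ : A → Ω} {e₁ e₂ : Evidence} →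
             φ₁ ⊢ e₁ ⟶ φ₂ → φ₂ ⊢ e₂ ⟶ φ₃ → φ₁ ⊢ e₁ ⨾ e₂ ⟶ φ₃
  trans-ev h₁ h₂ c = ≤-trans (h₁ c) (≤-trans (◇-mono h₂) ◇-compose)

  top-ev : (φ : A → Ω) → φ ⊢ e-id ⟶ (λ _ → 𝟏)
  top-ev _ _ = ≤-trans 𝟏-top ◇-I

  ⟨_,_⟩ : Evidence → Evidence → Evidence
  ⟨ (e₁ , s₁) , (e₂ , s₂) ⟩ = fork e₁ e₂ , S-comb 1 _ (((tt , s₁) , s₂) , tt)

  pair-ev : {φ φ₁ φ₂ : A → Ω} {e₁ e₂ : Evidence} →
            φ ⊢ e₁ ⟶ φ₁ → φ ⊢ e₂ ⟶ φ₂ → φ ⊢ ⟨ e₁ , e₂ ⟩ ⟶ (φ₁ ∧Φ φ₂)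
  pair-ev h₁ h₂ c =
    ≤-trans (∧-glb (≤-trans (h₁ c) (≤-trans ◇-true ◇-forked))
                   (≤-trans (h₂ c) (≤-trans ◇-false ◇-forked)))
            ◇-lam-suc

  e-fst : Evidence
  e-fst = applyTo true , S-comb 0 _ (tt , true∈S)

  fst-ev : (φ₁ φ₂ : A → Ω) → (φ₁ ∧Φ φ₂) ⊢ e-fst ⟶ φ₁
  fst-ev _ _ _ = ≤-trans ∧-lb₁ ◇-applyTo

  e-snd : Evidence
  e-snd = applyTo false , S-comb 0 _ (tt , false∈S)

  snd-ev : (φ₁ φ₂ : A → Ω) → (φ₁ ∧Φ φ₂) ⊢ e-snd ⟶ φ₂
  snd-ev _ _ _ = ≤-trans ∧-lb₂ ◇-applyTo

  λ-ev : Evidence → Evidence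
  λ-ev (e , s) = curry e , S-comb 1 _ (s , (pair∈S , tt) , tt)

  curry-ev : {φ₁ φ₂ : A → Ω} {P : (A → Ω) → Set ℓ} {e : Evidence} →
             ((φ : A → Ω) → P φ → (φ₁ ∧Φ φ₂) ⊢ e ⟶ φ) → φ₁ ⊢ λ-ev e ⟶ (φ₂ ⊃Φ P)
  curry-ev h c =
    ≤-trans (⊃Φ-intro (λ φ Pφ a → ≤-trans ∧Φ-pairing (≤-trans (h φ Pφ _) ◇-curried))) ◇-lam-suc

  e-eval : Evidence
  e-eval = applyPair , S-comb 0 _ ((tt , true∈S) , (tt , false∈S))

  eval-ev : (φ₁ : A → Ω) (P : (A → Ω) → Set ℓ) (φ : A → Ω) → P φ →
            ((φ₁ ⊃Φ P) ∧Φ φ₁) ⊢ e-eval ⟶ φ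
  eval-ev _ _ _ Pφ _ = ≤-trans (◇-sequence (λ _ _ → ⊃Φ-elim Pφ)) ◇-applyPair

theorem2 : {ℓ : Level} {𝕄 : Monad ℓ} (C : MonadicCore ℓ 𝕄) →
    EvidencedFrame ℓ (MonadicCore.A C → MonadicCore.Ω C) (Σ (MonadicCore.A C) (MonadicCore.S C)) (CoreEvidence C)
theorem2 C = record
  { e-id     = e-id
  ; refl-ev  = refl-ev
  ; _⨾_      = _⨾_
  -- evidence occurs in CoreEvidence only under proj₁, so it must be passed explicitly
  ; trans-ev = λ {_ _ _ e₁ e₂} → trans-ev {e₁ = e₁} {e₂}
  ; ⊤Φ       = λ _ → 𝟏
  ; e-⊤      = e-id
  ; top-ev   = top-ev
  ; _∧Φ_     = _∧Φ_
  ; ⟨_,_⟩    = ⟨_,_⟩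
  ; e-fst    = e-fst
  ; e-snd    = e-snd
  ; pair-ev  = λ {_ _ _ e₁ e₂} → pair-ev {e₁ = e₁} {e₂}
  ; fst-ev   = fst-ev
  ; snd-ev   = snd-ev
  ; _⊃_      = _⊃Φ_
  ; λ-ev     = λ-ev
  ; e-eval   = e-eval
  ; curry-ev = λ {_ _ _ e} → curry-ev {e = e}
  ; eval-ev  = eval-ev
  }
  where open MonadicCore C using (𝟏)
        open SeparatorEvidence C
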